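{- Let $p\geq5$ be prime and let $r,b,c,m\in\mathbb{Z}_{\geq0}$ with $2\leq b\leq p$, $r\equiv b\pmod{p-1}$ and $r\geq b+c(p-1)+1$. If $0\leq m\leq\min\{c-1-\epsilon_1,p-1\}$, then for all $1\leq a\leq c-m-\epsilon_1$, $$q(c-m-a)\equiv\sum_{i=1}^{m+1}(-1)^{i+1}\beta(a,i)\,q(c-m-1+i)\pmod{V_r^{(m+1)}}.$$
   Context: $V_r$ is the space of homogeneous polynomials of degree $r$ in $x,y$ over $\bar{\mathbb{F}}_p$; $\theta=x^py-xy^p$ and $V_r^{(m+1)}=\{f\in V_r:\theta^{m+1}\mid f \text{ in }\bar{\mathbb{F}}_p[x,y]\}$. $q(i)=x^{r-b+m-i(p-1)}y^{b-m+i(p-1)}$. $\epsilon_1=\epsilon_1(b,m)$: $0$ if $2m+1\leq b\leq p$; $1$ if $2m+1-(p-1)\leq b\leq 2m$; $2$ if $2\leq b\leq 2m-(p-1)$. $\beta(a,i)$ (for $a\geq1$, $1\leq i\leq m+1$) is defined by $\beta(1,i)=\binom{m+1}{i}$ and $\beta(a,i)=\sum_{l=1}^{a-1}(-1)^{l+1}\binom{m+1}{l}\beta(a-l,i)+(-1)^{a-1}\binom{m+1}{i+a-1}$ for $a\geq2$, with $\binom nk=0$ if $k<0$ or $k>n$. -}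

module Defs where

open import Data.Nat as ℕ using (ℕ; zero; suc; _∸_; _≤?_; _≟_)
open import Data.Nat.Combinatorics using (_C_)
open import Data.Integer as ℤ using (ℤ; +_; -_; _+_; _*_; _-_)
open import Data.Integer.Divisibility using (_∣_)
open import Data.List using (List; []; _∷_)
open import Data.Bool using (if_then_else_)
open import Data.Product using (Σ; _×_)
open import Relation.Nullary.Decidable using (⌊_⌋)
open import Relation.Binary.PropositionalEquality using (_≡_)

sgn : ℕ → ℤ
sgn zero    = + 1
sgn (suc n) = - sgn n

-- binomial coefficient as an integer (0 when k > n)
binom : ℕ → ℕ → ℤ
binom n k = + (n C k)

sumTo : ℕ → (ℕ → ℤ) → ℤ
sumTo zero    f = f 0
sumTo (suc n) f = sumTo n f + f (suc n)

-- Σ_{k=lo}^{hi} f k  (empty if hi < lo)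
sumFromTo : ℕ → ℕ → (ℕ → ℤ) → ℤ
sumFromTo lo zero f = if ⌊ lo ≟ 0 ⌋ then f 0 else + 0
sumFromTo lo (suc hi) f =
  if ⌊ lo ℕ.≤? suc hi ⌋ then sumFromTo lo hi f + f (suc hi) else + 0

-- β(a,i), parameter m.
-- betaList m i n = [ β(n,i) , β(n-1,i) , … , β(1,i) ].
-- The new entry β(n+1,i) is
--   Σ_{l=1}^{n} (-1)^{l+1} C(m+1,l) β(n+1-l,i) + (-1)^n C(m+1,i+n),
-- which for n = 0 gives β(1,i) = C(m+1,i), so one clause covers both
-- cases of the paper's definition.

betaSum : ℕ → ℕ → List ℤ → ℤ
betaSum m l []       = + 0
betaSum m l (x ∷ xs) = sgn (suc l) * binom (suc m) l * x + betaSum m (suc l) xs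

betaList : ℕ → ℕ → ℕ → List ℤ
betaList m i zero    = []
betaList m i (suc n) =
  (betaSum m 1 (betaList m i n) + sgn n * binom (suc m) (i ℕ.+ n)) ∷ betaList m i n

-- β(a,i) (meaningful for a ≥ 1; value 0 at a = 0 is never used)
β : (m a i : ℕ) → ℤ
β m a i with betaList m i a
... | []    = + 0
... | x ∷ _ = x

ε₁ : (p b m : ℕ) → ℕ
ε₁ p b m =
  if ⌊ suc (2 ℕ.* m) ℕ.≤? b ⌋ then 0
  else if ⌊ suc (2 ℕ.* m) ℕ.≤? b ℕ.+ (p ∸ 1) ⌋ then 1
  else 2

-- Polynomials in x,y with integer coefficients, read modulo p
-- (i.e. as elements of 𝔽_p[x,y] ⊆ 𝔽̄_p[x,y]).
-- A polynomial is its coefficient function: P i j = coeff of x^i y^j.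
Poly : Set
Poly = ℕ → ℕ → ℤ

Bounded : ℕ → Poly → Set
Bounded N P = ∀ i j → N ℕ.< i ℕ.+ j → P i j ≡ + 0

mono : ℕ → ℕ → Poly
mono e₁ e₂ i j = if ⌊ i ≟ e₁ ⌋ then (if ⌊ j ≟ e₂ ⌋ then + 1 else + 0) else + 0

_⊕_ : Poly → Poly → Poly
(P ⊕ Q) i j = P i j + Q i j

_⊖_ : Poly → Poly → Poly
(P ⊖ Q) i j = P i j - Q i j

_·_ : ℤ → Poly → Poly
(c · P) i j = c * P i j

_⊗_ : Poly → Poly → Poly
(P ⊗ Q) i j = sumTo i λ a → sumTo j λ b → P a b * Q (i ∸ a) (j ∸ b)

polySum : ℕ → ℕ → (ℕ → Poly) → Poly
polySum lo hi F i j = sumFromTo lo hi λ k → F k i j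

_^ᴾ_ : Poly → ℕ → Poly
P ^ᴾ zero  = mono 0 0
P ^ᴾ suc n = P ⊗ (P ^ᴾ n)

θ : ℕ → Poly
θ p = mono p 1 ⊖ mono 1 p

-- f ∈ V_r^{(m+1)}: θ^{m+1} divides f in 𝔽_p[x,y]
-- (coefficient equalities taken modulo p).
-- (Homogeneity of degree r is automatic for the f we apply this to.)
DivByθPow : (p m : ℕ) → Poly → Set
DivByθPow p m f =
  Σ Poly λ G → Σ ℕ λ N → Bounded N G ×
    (∀ i j → (+ p) ∣ (f i j - ((θ p ^ᴾ suc m) ⊗ G) i j))

CongV : (p m : ℕ) → Poly → Poly → Set
CongV p m f g = DivByθPow p m (f ⊖ g)

-- q(i) = x^{r-b+m-i(p-1)} y^{b-m+i(p-1)}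
-- (exponents are nonnegative in the range used, so ∸ is exact there)
q : (p r b m i : ℕ) → Poly
q p r b m i = mono (r ∸ Y) Y
  where Y = (b ℕ.+ i ℕ.* (p ∸ 1)) ∸ m

-- Writing p = p' + 1 and n = m + 1, the binomial theorem gives
--   θⁿ = Σ_{l ≤ n} (-1)ˡ C(n,l) x^{n+(n-l)p'} y^{n+lp'},
-- so θⁿ times a monomial is Σ_{l ≤ n} (-1)ˡ C(n,l) q(s+l) for a suitable s, as long as both
-- exponents of the monomial are nonnegative; for the y-exponent this is where s ≥ ε₁ enters,
-- for the x-exponent it is r > b + c p'. The resulting linear recurrence expresses q(c-m-a)
-- through q(c-m-a+1), …, q(c-m-a+n). Those of index below c-m are rewritten again by strong
-- induction on a, and collecting the coefficients of the terms q(c-m-1+i) reproduces the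
-- recursion defining β(a,i).
{-# OPTIONS --safe #-}
module Submission where

open import Defs
open import Data.Nat using (ℕ; _≤_; _+_; _*_; _∸_; suc)
open import Data.Nat.Primality using (Prime)
open import Data.Integer using (+_; _-_)
open import Data.Integer.Divisibility using (_∣_)

open import Data.Nat using (zero; _<_; _≮_; z≤n; s≤s; _≤?_; _≟_; _<?_; _⊔_)
import Data.Nat.Properties as ℕP
open import Data.Nat.Divisibility using (_∣0)
open import Data.Nat.Induction using (<-rec)
open import Data.Nat.Combinatorics using (_C_; nCk+nC[k+1]≡[n+1]C[k+1])
open import Data.Nat.Combinatorics.Specification using (k>n⇒nCk≡0)
open import Data.Integer as ℤ using (ℤ; -_)
import Data.Integer.Properties as ℤP
open import Data.Product using (Σ; _×_; _,_)
open import Data.Bool using (if_then_else_)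
open import Relation.Nullary.Decidable using (⌊_⌋)
open import Relation.Binary.PropositionalEquality
open ≡-Reasoning
open import Relation.Nullary using (yes; no)
open import Data.Empty using (⊥-elim)
open import Function using (_∘_; case_of_)
open import Algebra.Properties.CommutativeSemigroup ℤP.+-commutativeSemigroup
  using () renaming (interchange to +-interchange)
open import Algebra.Properties.CommutativeSemigroup ℤP.*-commutativeSemigroup
  using () renaming (x∙yz≈y∙xz to *-leftComm)
open import Algebra.Properties.Ring ℤP.+-*-ring using ([y-z]x≈yx-zx)
import Data.Nat.Tactic.RingSolver as ℕSolver
import Data.Integer.Tactic.RingSolver as ℤSolver

∑< : ℕ → (ℕ → ℤ) → ℤ
∑< zero    f = + 0
∑< (suc n) f = ∑< n f ℤ.+ f n

∑<-cong : ∀ n {f g : ℕ → ℤ} → (∀ k → k < n → f k ≡ g k) → ∑< n f ≡ ∑< n g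
∑<-cong zero    eq = refl
∑<-cong (suc n) eq = cong₂ ℤ._+_ (∑<-cong n λ k k<n → eq k (ℕP.m<n⇒m<1+n k<n)) (eq n (ℕP.n<1+n n))

∑<-cong′ : ∀ n {f g : ℕ → ℤ} → (∀ k → f k ≡ g k) → ∑< n f ≡ ∑< n g
∑<-cong′ n eq = ∑<-cong n λ k _ → eq k

∑<-zero : ∀ n {f : ℕ → ℤ} → (∀ k → k < n → f k ≡ + 0) → ∑< n f ≡ + 0
∑<-zero zero    eq = refl
∑<-zero (suc n) eq = cong₂ ℤ._+_ (∑<-zero n λ k k<n → eq k (ℕP.m<n⇒m<1+n k<n)) (eq n (ℕP.n<1+n n))

∑<-distrib-+ : ∀ n (f g : ℕ → ℤ) → ∑< n (λ k → f k ℤ.+ g k) ≡ ∑< n f ℤ.+ ∑< n g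
∑<-distrib-+ zero    f g = refl
∑<-distrib-+ (suc n) f g =
  trans (cong (ℤ._+ (f n ℤ.+ g n)) (∑<-distrib-+ n f g)) (+-interchange (∑< n f) (∑< n g) (f n) (g n))

∑<-distribˡ : ∀ n (c : ℤ) (f : ℕ → ℤ) → ∑< n (λ k → c ℤ.* f k) ≡ c ℤ.* ∑< n f
∑<-distribˡ zero    c f = sym (ℤP.*-zeroʳ c)
∑<-distribˡ (suc n) c f =
  trans (cong (ℤ._+ c ℤ.* f n) (∑<-distribˡ n c f)) (sym (ℤP.*-distribˡ-+ c (∑< n f) (f n)))

∑<-distribʳ : ∀ n (c : ℤ) (f : ℕ → ℤ) → ∑< n (λ k → f k ℤ.* c) ≡ ∑< n f ℤ.* c
∑<-distribʳ n c f =
  trans (∑<-cong′ n λ k → ℤP.*-comm (f k) c) (trans (∑<-distribˡ n c f) (ℤP.*-comm c (∑< n f)))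

∑<-neg : ∀ n (f : ℕ → ℤ) → ∑< n (λ k → - f k) ≡ - ∑< n f
∑<-neg n f = trans (∑<-cong′ n λ k → sym (ℤP.-1*i≡-i (f k)))
                   (trans (∑<-distribˡ n (ℤ.-[1+ 0 ]) f) (ℤP.-1*i≡-i (∑< n f)))

∑<-distrib-- : ∀ n (f g : ℕ → ℤ) → ∑< n (λ k → f k - g k) ≡ ∑< n f - ∑< n g
∑<-distrib-- n f g = trans (∑<-distrib-+ n f (λ k → - g k)) (cong (λ x → ∑< n f ℤ.+ x) (∑<-neg n g))

∑<-suc : ∀ n (f : ℕ → ℤ) → ∑< (suc n) f ≡ f 0 ℤ.+ ∑< n (λ k → f (suc k))
∑<-suc zero    f = ℤP.+-comm (+ 0) (f 0)
∑<-suc (suc n) f = trans (cong (ℤ._+ f (suc n)) (∑<-suc n f)) (ℤP.+-assoc (f 0) _ _)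

∑<-reverse : ∀ n (f : ℕ → ℤ) → ∑< n f ≡ ∑< n (λ k → f (n ∸ suc k))
∑<-reverse zero    f = refl
∑<-reverse (suc n) f = begin
  ∑< n f ℤ.+ f n                         ≡⟨ cong (ℤ._+ f n) (∑<-reverse n f) ⟩
  ∑< n (λ k → f (n ∸ suc k)) ℤ.+ f n     ≡⟨ ℤP.+-comm _ (f n) ⟩
  f n ℤ.+ ∑< n (λ k → f (n ∸ suc k))     ≡⟨ sym (∑<-suc n λ k → f (n ∸ k)) ⟩
  ∑< (suc n) (λ k → f (n ∸ k))           ∎

∑<-split : ∀ a b (f : ℕ → ℤ) → ∑< (a + b) f ≡ ∑< a f ℤ.+ ∑< b (λ k → f (a + k))
∑<-split a zero    f = trans (cong (λ x → ∑< x f) (ℕP.+-identityʳ a)) (sym (ℤP.+-identityʳ _))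
∑<-split a (suc b) f = trans (cong (λ x → ∑< x f) (ℕP.+-suc a b))
  (trans (cong (ℤ._+ f (a + b)) (∑<-split a b f)) (ℤP.+-assoc (∑< a f) _ _))

∑<-comm : ∀ n m (g : ℕ → ℕ → ℤ) →
  ∑< n (λ k → ∑< m (g k)) ≡ ∑< m (λ l → ∑< n (λ k → g k l))
∑<-comm zero    m g = sym (∑<-zero m λ _ _ → refl)
∑<-comm (suc n) m g = trans (cong (ℤ._+ ∑< m (g n)) (∑<-comm n m g))
                            (sym (∑<-distrib-+ m (λ l → ∑< n (λ k → g k l)) (g n)))

∑<-single : ∀ n j {f : ℕ → ℤ} → j < n → (∀ k → k < n → k ≢ j → f k ≡ + 0) → ∑< n f ≡ f j
∑<-single (suc n) j {f} j<1+n others with j ≟ n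
... | yes refl = trans (cong (ℤ._+ f j) (∑<-zero n λ k k<n → others k (ℕP.m<n⇒m<1+n k<n) (ℕP.<⇒≢ k<n)))
                       (ℤP.+-identityˡ (f j))
... | no j≢n   = trans (cong₂ ℤ._+_ (∑<-single n j (ℕP.≤∧≢⇒< (ℕP.≤-pred j<1+n) j≢n)
                                       λ k k<n → others k (ℕP.m<n⇒m<1+n k<n))
                                    (others n (ℕP.n<1+n n) (j≢n ∘ sym)))
                       (ℤP.+-identityʳ (f j))

∑<-resplit : ∀ n a (f : ℕ → ℤ) → (∀ k → k < a → f (n + k) ≡ + 0) →
  ∑< n f ≡ ∑< a f ℤ.+ ∑< n (λ k → f (a + k))
∑<-resplit n a f vanish = begin
  ∑< n f                               ≡⟨ sym (ℤP.+-identityʳ (∑< n f)) ⟩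
  ∑< n f ℤ.+ + 0                       ≡⟨ cong (λ x → ∑< n f ℤ.+ x) (sym (∑<-zero a vanish)) ⟩
  ∑< n f ℤ.+ ∑< a (λ k → f (n + k))    ≡⟨ sym (∑<-split n a f) ⟩
  ∑< (n + a) f                         ≡⟨ cong (λ x → ∑< x f) (ℕP.+-comm n a) ⟩
  ∑< (a + n) f                         ≡⟨ ∑<-split a n f ⟩
  ∑< a f ℤ.+ ∑< n (λ k → f (a + k))    ∎

sumTo≡∑< : ∀ n f → sumTo n f ≡ ∑< (suc n) f
sumTo≡∑< zero    f = sym (ℤP.+-identityˡ (f 0))
sumTo≡∑< (suc n) f = cong (ℤ._+ f (suc n)) (sumTo≡∑< n f)

sumFromTo1≡∑< : ∀ n f → sumFromTo 1 n f ≡ ∑< n (λ k → f (suc k))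
sumFromTo1≡∑< zero    f = refl
sumFromTo1≡∑< (suc n) f = cong (ℤ._+ f (suc n)) (sumFromTo1≡∑< n f)

infix 4 _≈_
_≈_ : Poly → Poly → Set
P ≈ Q = ∀ i j → P i j ≡ Q i j

0ᴾ : Poly
0ᴾ _ _ = + 0

lincomb : ℕ → (ℕ → ℤ) → (ℕ → Poly) → Poly
lincomb n c F i j = ∑< n (λ l → c l ℤ.* F l i j)

mono-≡ : ∀ a b → mono a b a b ≡ + 1
mono-≡ a b with a ≟ a | b ≟ b
... | yes _  | yes _  = refl
... | no a≢a | _      = ⊥-elim (a≢a refl)
... | yes _  | no b≢b = ⊥-elim (b≢b refl)

mono-≢₁ : ∀ {a b i} j → i ≢ a → mono a b i j ≡ + 0
mono-≢₁ {a} {b} {i} j i≢a with i ≟ a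
... | yes i≡a = ⊥-elim (i≢a i≡a)
... | no _    = refl

mono-≢₂ : ∀ {a b} i {j} → j ≢ b → mono a b i j ≡ + 0
mono-≢₂ {a} {b} i {j} j≢b with i ≟ a | j ≟ b
... | yes _ | yes j≡b = ⊥-elim (j≢b j≡b)
... | yes _ | no _    = refl
... | no _  | _       = refl

mono-bounded : ∀ a b → Bounded (a + b) (mono a b)
mono-bounded a b i j a+b<i+j with i ≟ a | j ≟ b
... | no _     | _        = refl
... | yes _    | no _     = refl
... | yes refl | yes refl = ⊥-elim (ℕP.<-irrefl refl a+b<i+j)

shift : ℕ → ℕ → Poly → Poly
shift e₁ e₂ Q i j with e₁ ≤? i | e₂ ≤? j
... | yes _ | yes _ = Q (i ∸ e₁) (j ∸ e₂)
... | _     | _     = + 0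

shift-cong : ∀ e₁ e₂ {P Q} → P ≈ Q → shift e₁ e₂ P ≈ shift e₁ e₂ Q
shift-cong e₁ e₂ P≈Q i j with e₁ ≤? i | e₂ ≤? j
... | yes _ | yes _ = P≈Q _ _
... | yes _ | no _  = refl
... | no _  | _     = refl

shift-lincomb : ∀ e₁ e₂ n c F → shift e₁ e₂ (lincomb n c F) ≈ lincomb n c (λ l → shift e₁ e₂ (F l))
shift-lincomb e₁ e₂ n c F i j with e₁ ≤? i | e₂ ≤? j
... | yes _ | yes _ = refl
... | yes _ | no _  = sym (∑<-zero n λ l _ → ℤP.*-zeroʳ (c l))
... | no _  | _     = sym (∑<-zero n λ l _ → ℤP.*-zeroʳ (c l))

∸≟-shift : ∀ {e i} a → e ≤ i → ⌊ i ∸ e ≟ a ⌋ ≡ ⌊ i ≟ a + e ⌋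
∸≟-shift {e} {i} a e≤i with i ∸ e ≟ a | i ≟ a + e
... | yes _       | yes _       = refl
... | no _        | no _        = refl
... | yes i∸e≡a   | no i≢a+e    = ⊥-elim (i≢a+e (trans (sym (ℕP.m∸n+n≡m e≤i)) (cong (_+ e) i∸e≡a)))
... | no i∸e≢a    | yes i≡a+e   = ⊥-elim (i∸e≢a (trans (cong (_∸ e) i≡a+e) (ℕP.m+n∸n≡m a e)))

shift-mono : ∀ e₁ e₂ a b → shift e₁ e₂ (mono a b) ≈ mono (a + e₁) (b + e₂)
shift-mono e₁ e₂ a b i j with e₁ ≤? i | e₂ ≤? j
... | yes e₁≤i | yes e₂≤j =
  cong₂ (λ u v → if u then (if v then + 1 else + 0) else + 0) (∸≟-shift a e₁≤i) (∸≟-shift b e₂≤j)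
... | yes _    | no e₂≰j  =
  sym (mono-≢₂ i λ j≡b+e₂ → e₂≰j (subst (e₂ ≤_) (sym j≡b+e₂) (ℕP.m≤n+m e₂ b)))
... | no e₁≰i  | _        =
  sym (mono-≢₁ j λ i≡a+e₁ → e₁≰i (subst (e₁ ≤_) (sym i≡a+e₁) (ℕP.m≤n+m e₁ a)))

⊗-as-∑< : ∀ P Q i j →
  (P ⊗ Q) i j ≡ ∑< (suc i) (λ a → ∑< (suc j) (λ b → P a b ℤ.* Q (i ∸ a) (j ∸ b)))
⊗-as-∑< P Q i j = trans (sumTo≡∑< i _) (∑<-cong′ (suc i) λ a → sumTo≡∑< j _)

⊗-vanishes : ∀ P Q i j → (∀ a b → a ≤ i → b ≤ j → P a b ≡ + 0) → (P ⊗ Q) i j ≡ + 0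
⊗-vanishes P Q i j P≡0 = trans (⊗-as-∑< P Q i j) (∑<-zero (suc i) λ a a<1+i → ∑<-zero (suc j) λ b b<1+j →
  trans (cong (ℤ._* Q (i ∸ a) (j ∸ b)) (P≡0 a b (ℕP.≤-pred a<1+i) (ℕP.≤-pred b<1+j)))
        (ℤP.*-zeroˡ (Q (i ∸ a) (j ∸ b))))

⊗-comm : ∀ P Q → (P ⊗ Q) ≈ (Q ⊗ P)
⊗-comm P Q i j = begin
  (P ⊗ Q) i j
    ≡⟨ ⊗-as-∑< P Q i j ⟩
  ∑< (suc i) (λ a → ∑< (suc j) (λ b → P a b ℤ.* Q (i ∸ a) (j ∸ b)))
    ≡⟨ ∑<-reverse (suc i) _ ⟩
  ∑< (suc i) (λ a → ∑< (suc j) (λ b → P (i ∸ a) b ℤ.* Q (i ∸ (i ∸ a)) (j ∸ b)))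
    ≡⟨ ∑<-cong′ (suc i) (λ a → ∑<-reverse (suc j) _) ⟩
  ∑< (suc i) (λ a → ∑< (suc j) (λ b → P (i ∸ a) (j ∸ b) ℤ.* Q (i ∸ (i ∸ a)) (j ∸ (j ∸ b))))
    ≡⟨ ∑<-cong (suc i) (λ a a<1+i → ∑<-cong (suc j) λ b b<1+j →
         trans (cong₂ (λ u v → P (i ∸ a) (j ∸ b) ℤ.* Q u v)
                      (ℕP.m∸[m∸n]≡n (ℕP.≤-pred a<1+i)) (ℕP.m∸[m∸n]≡n (ℕP.≤-pred b<1+j)))
               (ℤP.*-comm (P (i ∸ a) (j ∸ b)) (Q a b))) ⟩
  ∑< (suc i) (λ a → ∑< (suc j) (λ b → Q a b ℤ.* P (i ∸ a) (j ∸ b)))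
    ≡⟨ sym (⊗-as-∑< Q P i j) ⟩
  (Q ⊗ P) i j ∎

mono-⊗ : ∀ e₁ e₂ Q → (mono e₁ e₂ ⊗ Q) ≈ shift e₁ e₂ Q
mono-⊗ e₁ e₂ Q i j with e₁ ≤? i | e₂ ≤? j
... | yes e₁≤i | yes e₂≤j = begin
  (mono e₁ e₂ ⊗ Q) i j
    ≡⟨ ⊗-as-∑< (mono e₁ e₂) Q i j ⟩
  ∑< (suc i) row
    ≡⟨ ∑<-single (suc i) e₁ (s≤s e₁≤i) (λ a _ a≢e₁ → ∑<-zero (suc j) λ b _ →
         trans (cong (ℤ._* Q (i ∸ a) (j ∸ b)) (mono-≢₁ {b = e₂} b a≢e₁)) (ℤP.*-zeroˡ (Q (i ∸ a) (j ∸ b)))) ⟩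
  row e₁
    ≡⟨ ∑<-single (suc j) e₂ (s≤s e₂≤j) (λ b _ b≢e₂ →
         trans (cong (ℤ._* Q (i ∸ e₁) (j ∸ b)) (mono-≢₂ {a = e₁} e₁ b≢e₂)) (ℤP.*-zeroˡ (Q (i ∸ e₁) (j ∸ b)))) ⟩
  mono e₁ e₂ e₁ e₂ ℤ.* Q (i ∸ e₁) (j ∸ e₂)
    ≡⟨ trans (cong (ℤ._* Q (i ∸ e₁) (j ∸ e₂)) (mono-≡ e₁ e₂)) (ℤP.*-identityˡ _) ⟩
  Q (i ∸ e₁) (j ∸ e₂) ∎
  where
  row : ℕ → ℤ
  row a = ∑< (suc j) (λ b → mono e₁ e₂ a b ℤ.* Q (i ∸ a) (j ∸ b))
... | yes _ | no e₂≰j = ⊗-vanishes (mono e₁ e₂) Q i j λ a b _ b≤j →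
  mono-≢₂ {a = e₁} a λ b≡e₂ → e₂≰j (subst (_≤ j) b≡e₂ b≤j)
... | no e₁≰i | _ = ⊗-vanishes (mono e₁ e₂) Q i j λ a b a≤i _ →
  mono-≢₁ {b = e₂} b λ a≡e₁ → e₁≰i (subst (_≤ i) a≡e₁ a≤i)

⊗-mono : ∀ e₁ e₂ P → (P ⊗ mono e₁ e₂) ≈ shift e₁ e₂ P
⊗-mono e₁ e₂ P i j = trans (⊗-comm P (mono e₁ e₂) i j) (mono-⊗ e₁ e₂ P i j)

⊗-congˡ : ∀ P {G H} → G ≈ H → (P ⊗ G) ≈ (P ⊗ H)
⊗-congˡ P {G} {H} G≈H i j = trans (⊗-as-∑< P G i j) (trans
  (∑<-cong′ (suc i) λ a → ∑<-cong′ (suc j) λ b → cong (P a b ℤ.*_) (G≈H (i ∸ a) (j ∸ b)))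
  (sym (⊗-as-∑< P H i j)))

⊗-distribʳ-⊖ : ∀ A B X → ((A ⊖ B) ⊗ X) ≈ ((A ⊗ X) ⊖ (B ⊗ X))
⊗-distribʳ-⊖ A B X i j = trans (⊗-as-∑< (A ⊖ B) X i j) (trans
  (∑<-cong′ (suc i) λ a → trans (∑<-cong′ (suc j) λ b → [y-z]x≈yx-zx _ (A a b) (B a b))
                                (∑<-distrib-- (suc j) _ _))
  (trans (∑<-distrib-- (suc i) _ _) (sym (cong₂ _-_ (⊗-as-∑< A X i j) (⊗-as-∑< B X i j)))))

⊗-distribˡ-⊕ : ∀ P G H → (P ⊗ (G ⊕ H)) ≈ ((P ⊗ G) ⊕ (P ⊗ H))
⊗-distribˡ-⊕ P G H i j = trans (⊗-as-∑< P (G ⊕ H) i j) (trans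
  (∑<-cong′ (suc i) λ a → trans (∑<-cong′ (suc j) λ b → ℤP.*-distribˡ-+ (P a b) _ _)
                                (∑<-distrib-+ (suc j) _ _))
  (trans (∑<-distrib-+ (suc i) _ _) (sym (cong₂ ℤ._+_ (⊗-as-∑< P G i j) (⊗-as-∑< P H i j)))))

⊗-·ʳ : ∀ P c G → (P ⊗ (c · G)) ≈ (c · (P ⊗ G))
⊗-·ʳ P c G i j = trans (⊗-as-∑< P (c · G) i j) (trans
  (∑<-cong′ (suc i) λ a → trans (∑<-cong′ (suc j) λ b → *-leftComm (P a b) c _)
                                (∑<-distribˡ (suc j) c _))
  (trans (∑<-distribˡ (suc i) c _) (cong (c ℤ.*_) (sym (⊗-as-∑< P G i j)))))

⊗-zeroʳ : ∀ P → (P ⊗ 0ᴾ) ≈ 0ᴾ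
⊗-zeroʳ P i j = trans (⊗-comm P 0ᴾ i j) (⊗-vanishes 0ᴾ P i j λ _ _ _ _ → refl)

signedBinom : ℕ → ℕ → ℤ
signedBinom n l = sgn l ℤ.* binom n l

signedBinom-pascal : ∀ n l → signedBinom (suc n) (suc l) ≡ signedBinom n (suc l) - signedBinom n l
signedBinom-pascal n l = begin
  - sgn l ℤ.* + (suc n C suc l)                ≡⟨ cong (λ x → - sgn l ℤ.* + x) (sym (nCk+nC[k+1]≡[n+1]C[k+1] n l)) ⟩
  - sgn l ℤ.* (+ (n C l) ℤ.+ + (n C suc l))    ≡⟨ regroup (sgn l) (+ (n C l)) (+ (n C suc l)) ⟩
  - sgn l ℤ.* + (n C suc l) - sgn l ℤ.* + (n C l) ∎
  where
  regroup : ∀ s x y → - s ℤ.* (x ℤ.+ y) ≡ - s ℤ.* y - s ℤ.* x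
  regroup = ℤSolver.solve-∀

signedBinom-vanishes : ∀ n k → signedBinom n (suc (n + k)) ≡ + 0
signedBinom-vanishes n k =
  trans (cong (λ x → sgn (suc (n + k)) ℤ.* + x) (k>n⇒nCk≡0 (s≤s (ℕP.m≤m+n n k)))) (ℤP.*-zeroʳ (sgn (suc (n + k))))

∑<-signedBinom-pascal : ∀ n (N : ℕ → ℤ) →
  ∑< (suc (suc n)) (λ l → signedBinom (suc n) l ℤ.* N l)
    ≡ ∑< (suc n) (λ l → signedBinom n l ℤ.* N l) - ∑< (suc n) (λ l → signedBinom n l ℤ.* N (suc l))
∑<-signedBinom-pascal n N = begin
  ∑< (suc (suc n)) (λ l → signedBinom (suc n) l ℤ.* N l)
    ≡⟨ ∑<-suc (suc n) _ ⟩
  + 1 ℤ.* N 0 ℤ.+ ∑< (suc n) (λ l → signedBinom (suc n) (suc l) ℤ.* N (suc l))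
    ≡⟨ cong (λ x → + 1 ℤ.* N 0 ℤ.+ x) (∑<-cong′ (suc n) λ l →
         trans (cong (ℤ._* N (suc l)) (signedBinom-pascal n l)) ([y-z]x≈yx-zx (N (suc l)) (signedBinom n (suc l)) (signedBinom n l))) ⟩
  + 1 ℤ.* N 0 ℤ.+ ∑< (suc n) (λ l → signedBinom n (suc l) ℤ.* N (suc l) - signedBinom n l ℤ.* N (suc l))
    ≡⟨ cong (λ x → + 1 ℤ.* N 0 ℤ.+ x) (∑<-distrib-- (suc n) _ _) ⟩
  + 1 ℤ.* N 0 ℤ.+ (∑< (suc n) (λ l → signedBinom n (suc l) ℤ.* N (suc l)) - Y)
    ≡⟨ sym (ℤP.+-assoc (+ 1 ℤ.* N 0) _ (- Y)) ⟩
  + 1 ℤ.* N 0 ℤ.+ ∑< (suc n) (λ l → signedBinom n (suc l) ℤ.* N (suc l)) - Y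
    ≡⟨ cong (_- Y) (sym (∑<-suc (suc n) λ l → signedBinom n l ℤ.* N l)) ⟩
  ∑< (suc n) (λ l → signedBinom n l ℤ.* N l) ℤ.+ signedBinom n (suc n) ℤ.* N (suc n) - Y
    ≡⟨ cong (λ c → ∑< (suc n) (λ l → signedBinom n l ℤ.* N l) ℤ.+ c ℤ.* N (suc n) - Y)
            (trans (cong (signedBinom n ∘ suc) (sym (ℕP.+-identityʳ n))) (signedBinom-vanishes n 0)) ⟩
  ∑< (suc n) (λ l → signedBinom n l ℤ.* N l) ℤ.+ + 0 ℤ.* N (suc n) - Y
    ≡⟨ cong (_- Y) (ℤP.+-identityʳ (∑< (suc n) (λ l → signedBinom n l ℤ.* N l))) ⟩
  ∑< (suc n) (λ l → signedBinom n l ℤ.* N l) - Y ∎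
  where
  Y : ℤ
  Y = ∑< (suc n) (λ l → signedBinom n l ℤ.* N (suc l))

module _ (p' : ℕ) where

  θTerm : ℕ → ℕ → Poly
  θTerm n l = mono (n + (n ∸ l) * p') (n + l * p')

  private
    xExponent : ∀ a d k → a + d * k + suc k ≡ suc a + suc d * k
    xExponent = ℕSolver.solve-∀

    yExponent : ∀ a x → a + x + 1 ≡ suc a + x
    yExponent = ℕSolver.solve-∀

  shift-θTerm-x : ∀ n l → l ≤ n → shift (suc p') 1 (θTerm n l) ≈ θTerm (suc n) l
  shift-θTerm-x n l l≤n i j = trans (shift-mono (suc p') 1 _ _ i j) (cong₂ (λ u v → mono u v i j)
    (trans (xExponent n (n ∸ l) p') (cong (λ d → suc n + d * p') (sym (ℕP.+-∸-assoc 1 l≤n))))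
    (yExponent n (l * p')))

  shift-θTerm-y : ∀ n l → shift 1 (suc p') (θTerm n l) ≈ θTerm (suc n) (suc l)
  shift-θTerm-y n l i j = trans (shift-mono 1 (suc p') _ _ i j) (cong₂ (λ u v → mono u v i j)
    (yExponent n ((n ∸ l) * p'))
    (xExponent n l p'))

  θ^-expansion : ∀ n → (θ (suc p') ^ᴾ n) ≈ lincomb (suc n) (signedBinom n) (θTerm n)
  θ^-expansion zero i j = sym (trans (ℤP.+-identityˡ (+ 1 ℤ.* mono 0 0 i j)) (ℤP.*-identityˡ (mono 0 0 i j)))
  θ^-expansion (suc n) i j = begin
    (θ p ⊗ (θ p ^ᴾ n)) i j
      ≡⟨ ⊗-congˡ (θ p) (θ^-expansion n) i j ⟩
    (θ p ⊗ L) i j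
      ≡⟨ ⊗-distribʳ-⊖ (mono p 1) (mono 1 p) L i j ⟩
    (mono p 1 ⊗ L) i j - (mono 1 p ⊗ L) i j
      ≡⟨ cong₂ _-_ (mono-⊗ p 1 L i j) (mono-⊗ 1 p L i j) ⟩
    shift p 1 L i j - shift 1 p L i j
      ≡⟨ cong₂ _-_ (shift-lincomb p 1 (suc n) (signedBinom n) (θTerm n) i j)
                   (shift-lincomb 1 p (suc n) (signedBinom n) (θTerm n) i j) ⟩
    lincomb (suc n) (signedBinom n) (shift p 1 ∘ θTerm n) i j
      - lincomb (suc n) (signedBinom n) (shift 1 p ∘ θTerm n) i j
      ≡⟨ cong₂ _-_
           (∑<-cong (suc n) λ l l<1+n → cong (signedBinom n l ℤ.*_) (shift-θTerm-x n l (ℕP.≤-pred l<1+n) i j))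
           (∑<-cong′ (suc n) λ l → cong (signedBinom n l ℤ.*_) (shift-θTerm-y n l i j)) ⟩
    ∑< (suc n) (λ l → signedBinom n l ℤ.* θTerm (suc n) l i j)
      - ∑< (suc n) (λ l → signedBinom n l ℤ.* θTerm (suc n) (suc l) i j)
      ≡⟨ sym (∑<-signedBinom-pascal n λ l → θTerm (suc n) l i j) ⟩
    lincomb (suc (suc n)) (signedBinom (suc n)) (θTerm (suc n)) i j ∎
    where
    p : ℕ
    p = suc p'
    L : Poly
    L = lincomb (suc n) (signedBinom n) (θTerm n)

record IsSubmodule (D : Poly → Set) : Set₁ where
  field
    resp-≈    : ∀ {f g} → f ≈ g → D f → D g
    0ᴾ-closed : D 0ᴾ
    ⊕-closed  : ∀ {f g} → D f → D g → D (f ⊕ g)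
    ·-closed  : ∀ c {f} → D f → D (c · f)

  lincomb-closed : ∀ n c F → (∀ k → k < n → D (F k)) → D (lincomb n c F)
  lincomb-closed zero    c F _  = 0ᴾ-closed
  lincomb-closed (suc n) c F DF =
    ⊕-closed (lincomb-closed n c F λ k k<n → DF k (ℕP.m<n⇒m<1+n k<n)) (·-closed (c n) (DF n (ℕP.n<1+n n)))

Multiple : Poly → Poly → Set
Multiple T f = Σ Poly λ G → Σ ℕ λ N → Bounded N G × f ≈ (T ⊗ G)

Multiple-isSubmodule : ∀ T → IsSubmodule (Multiple T)
Multiple-isSubmodule T = record
  { resp-≈    = λ f≈g (G , N , bd , f≈TG) → G , N , bd , λ i j → trans (sym (f≈g i j)) (f≈TG i j)
  ; 0ᴾ-closed = 0ᴾ , 0 , (λ _ _ _ → refl) , λ i j → sym (⊗-zeroʳ T i j)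
  ; ⊕-closed  = λ (G , N , bd , f≈TG) (H , M , bd′ , g≈TH) →
      G ⊕ H , N ⊔ M ,
      (λ i j N⊔M<i+j → cong₂ ℤ._+_ (bd i j (ℕP.≤-<-trans (ℕP.m≤m⊔n N M) N⊔M<i+j))
                                   (bd′ i j (ℕP.≤-<-trans (ℕP.m≤n⊔m N M) N⊔M<i+j))) ,
      λ i j → trans (cong₂ ℤ._+_ (f≈TG i j) (g≈TH i j)) (sym (⊗-distribˡ-⊕ T G H i j))
  ; ·-closed  = λ c (G , N , bd , f≈TG) →
      c · G , N , (λ i j N<i+j → trans (cong (c ℤ.*_) (bd i j N<i+j)) (ℤP.*-zeroʳ c)) ,
      λ i j → trans (cong (c ℤ.*_) (f≈TG i j)) (sym (⊗-·ʳ T c G i j))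
  }

Multiple⇒DivByθPow : ∀ p m {f} → Multiple (θ p ^ᴾ suc m) f → DivByθPow p m f
Multiple⇒DivByθPow p m (G , N , bd , f≈TG) =
  G , N , bd , λ i j →
    subst ((+ p) ∣_) (sym (trans (cong (_- _) (f≈TG i j)) (ℤP.+-inverseʳ (((θ p ^ᴾ suc m) ⊗ G) i j)))) (p ∣0)

θ^⊗mono : ∀ p' n e₁ e₂ → Multiple (θ (suc p') ^ᴾ n)
  (lincomb (suc n) (signedBinom n) λ l → mono (n + (n ∸ l) * p' + e₁) (n + l * p' + e₂))
θ^⊗mono p' n e₁ e₂ = mono e₁ e₂ , e₁ + e₂ , mono-bounded e₁ e₂ , λ i j → sym (begin
  ((θ (suc p') ^ᴾ n) ⊗ mono e₁ e₂) i j
    ≡⟨ ⊗-mono e₁ e₂ _ i j ⟩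
  shift e₁ e₂ (θ (suc p') ^ᴾ n) i j
    ≡⟨ shift-cong e₁ e₂ (θ^-expansion p' n) i j ⟩
  shift e₁ e₂ (lincomb (suc n) (signedBinom n) (θTerm p' n)) i j
    ≡⟨ shift-lincomb e₁ e₂ (suc n) (signedBinom n) (θTerm p' n) i j ⟩
  lincomb (suc n) (signedBinom n) (λ l → shift e₁ e₂ (θTerm p' n l)) i j
    ≡⟨ ∑<-cong′ (suc n) (λ l → cong (signedBinom n l ℤ.*_) (shift-mono e₁ e₂ _ _ i j)) ⟩
  lincomb (suc n) (signedBinom n) (λ l → mono (n + (n ∸ l) * p' + e₁) (n + l * p' + e₂)) i j ∎)

∑<-substitute : ∀ n N (c w v : ℕ → ℤ) (e : ℕ → ℕ → ℤ) →
  ∑< (suc n) (λ l → c l ℤ.* w l) ℤ.+ ∑< n (λ l → - c (suc l) ℤ.* (w (suc l) - ∑< N (λ k → e l k ℤ.* v k)))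
    ≡ c 0 ℤ.* w 0 ℤ.+ ∑< N (λ k → ∑< n (λ l → c (suc l) ℤ.* e l k) ℤ.* v k)
∑<-substitute n N c w v e = begin
  ∑< (suc n) (λ l → c l ℤ.* w l) ℤ.+ ∑< n (λ l → - c (suc l) ℤ.* (w (suc l) - ∑< N (e′ l)))
    ≡⟨ cong₂ ℤ._+_ (∑<-suc n _) (trans (∑<-cong′ n λ l → expand (c (suc l)) (w (suc l)) (∑< N (e′ l)))
                                       (∑<-distrib-+ n _ _)) ⟩
  c 0 ℤ.* w 0 ℤ.+ X ℤ.+ (∑< n (λ l → - (c (suc l) ℤ.* w (suc l))) ℤ.+ ∑< n (λ l → c (suc l) ℤ.* ∑< N (e′ l)))
    ≡⟨ cong₂ (λ x y → c 0 ℤ.* w 0 ℤ.+ X ℤ.+ (x ℤ.+ y)) (∑<-neg n _) exchange ⟩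
  c 0 ℤ.* w 0 ℤ.+ X ℤ.+ (- X ℤ.+ Z)
    ≡⟨ cancel (c 0 ℤ.* w 0) X Z ⟩
  c 0 ℤ.* w 0 ℤ.+ Z ∎
  where
  e′ : ℕ → ℕ → ℤ
  e′ l k = e l k ℤ.* v k
  X : ℤ
  X = ∑< n (λ l → c (suc l) ℤ.* w (suc l))
  Z : ℤ
  Z = ∑< N (λ k → ∑< n (λ l → c (suc l) ℤ.* e l k) ℤ.* v k)
  expand : ∀ a x y → - a ℤ.* (x - y) ≡ - (a ℤ.* x) ℤ.+ a ℤ.* y
  expand = ℤSolver.solve-∀
  cancel : ∀ a x z → a ℤ.+ x ℤ.+ (- x ℤ.+ z) ≡ a ℤ.+ z
  cancel = ℤSolver.solve-∀
  exchange : ∑< n (λ l → c (suc l) ℤ.* ∑< N (e′ l)) ≡ Z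
  exchange = begin
    ∑< n (λ l → c (suc l) ℤ.* ∑< N (e′ l))            ≡⟨ ∑<-cong′ n (λ l → sym (∑<-distribˡ N (c (suc l)) (e′ l))) ⟩
    ∑< n (λ l → ∑< N (λ k → c (suc l) ℤ.* e′ l k))    ≡⟨ ∑<-comm n N _ ⟩
    ∑< N (λ k → ∑< n (λ l → c (suc l) ℤ.* e′ l k))
      ≡⟨ ∑<-cong′ N (λ k → trans (∑<-cong′ n λ l → sym (ℤP.*-assoc (c (suc l)) (e l k) (v k)))
                                  (∑<-distribʳ n (v k) _)) ⟩
    Z ∎

sgn-+ : ∀ x y → sgn (x + y) ≡ sgn x ℤ.* sgn y
sgn-+ zero    y = sym (ℤP.*-identityˡ (sgn y))
sgn-+ (suc x) y = trans (cong -_ (sgn-+ x y)) (ℤP.neg-distribˡ-* (sgn x) (sgn y))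

betaSum≡∑< : ∀ m i a k →
  betaSum m k (betaList m i a) ≡ ∑< a (λ t → sgn (suc (k + t)) ℤ.* binom (suc m) (k + t) ℤ.* β m (a ∸ t) i)
betaSum≡∑< m i zero    k = refl
betaSum≡∑< m i (suc a) k = trans
  (cong₂ ℤ._+_ (cong (λ x → sgn (suc x) ℤ.* binom (suc m) x ℤ.* β m (suc a) i) (sym (ℕP.+-identityʳ k)))
               (trans (betaSum≡∑< m i a (suc k)) (∑<-cong′ a λ t →
                  cong (λ x → sgn (suc x) ℤ.* binom (suc m) x ℤ.* β m (a ∸ t) i) (sym (ℕP.+-suc k t)))))
  (sym (∑<-suc a _))

β-suc : ∀ m a i → β m (suc a) i ≡
  ∑< a (λ t → sgn (suc (suc t)) ℤ.* binom (suc m) (suc t) ℤ.* β m (a ∸ t) i) ℤ.+ sgn a ℤ.* binom (suc m) (i + a)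
β-suc m a i = cong (ℤ._+ sgn a ℤ.* binom (suc m) (i + a)) (betaSum≡∑< m i a 1)

δ : ℕ → ℕ → ℤ
δ x y = if ⌊ x ≟ y ⌋ then + 1 else + 0

δ-refl : ∀ x → δ x x ≡ + 1
δ-refl x with x ≟ x
... | yes _   = refl
... | no x≢x  = ⊥-elim (x≢x refl)

δ-≢ : ∀ {x y} → x ≢ y → δ x y ≡ + 0
δ-≢ {x} {y} x≢y with x ≟ y
... | yes x≡y = ⊥-elim (x≢y x≡y)
... | no _    = refl

-- The coefficient of q(c-1+(k+1)) in q(c-(a+1)+(l+1)) after reduction: for l < a the latter is
-- q(c-(a-l)), reduced by the induction hypothesis; otherwise it is itself one of the q(c-1+(k+1)).
expansionCoeff : (m a l k : ℕ) → ℤ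
expansionCoeff m a l k with l <? a
... | yes _ = sgn (suc (suc k)) ℤ.* β m (a ∸ l) (suc k)
... | no _  = δ k (l ∸ a)

expansionCoeff-< : ∀ m {a l} k → l < a → expansionCoeff m a l k ≡ sgn (suc (suc k)) ℤ.* β m (a ∸ l) (suc k)
expansionCoeff-< m {a} {l} k l<a with l <? a
... | yes _  = refl
... | no l≮a = ⊥-elim (l≮a l<a)

expansionCoeff-≮ : ∀ m {a l} k → l ≮ a → expansionCoeff m a l k ≡ δ k (l ∸ a)
expansionCoeff-≮ m {a} {l} k l≮a with l <? a
... | yes l<a = ⊥-elim (l≮a l<a)
... | no _    = refl

∑<-signedBinom-expansionCoeff : ∀ m a k → k < suc m →
  ∑< (suc m) (λ l → signedBinom (suc m) (suc l) ℤ.* expansionCoeff m a l k)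
    ≡ - (sgn (suc (suc k)) ℤ.* β m (suc a) (suc k))
∑<-signedBinom-expansionCoeff m a k k<n = begin
  ∑< n f
    ≡⟨ ∑<-resplit n a f (λ t _ → trans (cong (ℤ._* expansionCoeff m a (n + t) k) (signedBinom-vanishes n t))
                                        (ℤP.*-zeroˡ (expansionCoeff m a (n + t) k))) ⟩
  ∑< a f ℤ.+ ∑< n (λ t → f (a + t))
    ≡⟨ cong₂ ℤ._+_ reduced target ⟩
  - (σ ℤ.* B) ℤ.+ signedBinom n (suc (a + k)) ℤ.* + 1
    ≡⟨ cong (λ x → - (σ ℤ.* B) ℤ.+ x ℤ.* + 1) lastTerm ⟩
  - (σ ℤ.* B) ℤ.+ - (σ ℤ.* sgn a) ℤ.* binom n (suc k + a) ℤ.* + 1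
    ≡⟨ regroup σ B (sgn a) (binom n (suc k + a)) ⟩
  - (σ ℤ.* (B ℤ.+ sgn a ℤ.* binom n (suc k + a)))
    ≡⟨ cong (λ x → - (σ ℤ.* x)) (sym (β-suc m a (suc k))) ⟩
  - (σ ℤ.* β m (suc a) (suc k)) ∎
  where
  n : ℕ
  n = suc m
  σ : ℤ
  σ = sgn (suc (suc k))
  f : ℕ → ℤ
  f l = signedBinom n (suc l) ℤ.* expansionCoeff m a l k
  B : ℤ
  B = ∑< a (λ t → sgn (suc (suc t)) ℤ.* binom n (suc t) ℤ.* β m (a ∸ t) (suc k))
  reduced : ∑< a f ≡ - (σ ℤ.* B)
  reduced = begin
    ∑< a f
      ≡⟨ ∑<-cong a (λ t t<a → trans (cong (signedBinom n (suc t) ℤ.*_) (expansionCoeff-< m k t<a))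
                                    (pull (sgn t) (binom n (suc t)) σ (β m (a ∸ t) (suc k)))) ⟩
    ∑< a (λ t → - (σ ℤ.* (sgn (suc (suc t)) ℤ.* binom n (suc t) ℤ.* β m (a ∸ t) (suc k))))
      ≡⟨ ∑<-neg a _ ⟩
    - ∑< a (λ t → σ ℤ.* (sgn (suc (suc t)) ℤ.* binom n (suc t) ℤ.* β m (a ∸ t) (suc k)))
      ≡⟨ cong -_ (∑<-distribˡ a σ _) ⟩
    - (σ ℤ.* B) ∎
    where
    pull : ∀ s b σ x → - s ℤ.* b ℤ.* (σ ℤ.* x) ≡ - (σ ℤ.* (- - s ℤ.* b ℤ.* x))
    pull = ℤSolver.solve-∀
  target : ∑< n (λ t → f (a + t)) ≡ signedBinom n (suc (a + k)) ℤ.* + 1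
  target = trans
    (∑<-single n k k<n λ t _ t≢k → trans
      (cong (signedBinom n (suc (a + t)) ℤ.*_)
            (trans (expansionCoeff-≮ m k (ℕP.≤⇒≯ (ℕP.m≤m+n a t)))
                   (δ-≢ λ k≡a+t∸a → t≢k (sym (trans k≡a+t∸a (ℕP.m+n∸m≡n a t))))))
      (ℤP.*-zeroʳ (signedBinom n (suc (a + t)))))
    (cong (signedBinom n (suc (a + k)) ℤ.*_)
      (trans (expansionCoeff-≮ m k (ℕP.≤⇒≯ (ℕP.m≤m+n a k)))
             (trans (cong (δ k) (ℕP.m+n∸m≡n a k)) (δ-refl k))))
  lastTerm : sgn (suc (a + k)) ℤ.* binom n (suc (a + k)) ≡ - (σ ℤ.* sgn a) ℤ.* binom n (suc k + a)
  lastTerm = begin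
    sgn (suc (a + k)) ℤ.* binom n (suc (a + k))
      ≡⟨ cong (λ x → sgn (suc x) ℤ.* binom n (suc x)) (ℕP.+-comm a k) ⟩
    sgn (suc (k + a)) ℤ.* binom n (suc k + a)
      ≡⟨ cong (ℤ._* binom n (suc k + a)) (sym (ℤP.neg-involutive (sgn (suc (k + a))))) ⟩
    - sgn (suc (suc (k + a))) ℤ.* binom n (suc k + a)
      ≡⟨ cong (λ x → - x ℤ.* binom n (suc k + a)) (sgn-+ (suc (suc k)) a) ⟩
    - (σ ℤ.* sgn a) ℤ.* binom n (suc k + a) ∎
  regroup : ∀ σ B s c → - (σ ℤ.* B) ℤ.+ - (σ ℤ.* s) ℤ.* c ℤ.* + 1 ≡ - (σ ℤ.* (B ℤ.+ s ℤ.* c))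
  regroup = ℤSolver.solve-∀

m∸[1+n]+[1+o]≡m∸n+o : ∀ m {n} o → suc n ≤ m → m ∸ suc n + suc o ≡ m ∸ n + o
m∸[1+n]+[1+o]≡m∸n+o m {n} o n<m = trans (ℕP.+-suc (m ∸ suc n) o) (cong (_+ o) (sym (ℕP.+-∸-assoc 1 n<m)))

m∸n+o≡m∸[n∸o] : ∀ m {n o} → n ≤ m → o ≤ n → m ∸ n + o ≡ m ∸ (n ∸ o)
m∸n+o≡m∸[n∸o] m {n}     {zero}  _   _         = ℕP.+-identityʳ (m ∸ n)
m∸n+o≡m∸[n∸o] m {suc n} {suc o} n<m (s≤s o≤n) =
  trans (m∸[1+n]+[1+o]≡m∸n+o m o n<m) (m∸n+o≡m∸[n∸o] m (ℕP.<⇒≤ n<m) o≤n)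

m∸[1+n]+[1+o]≡m∸1+[1+o∸n] : ∀ m {n o} → suc n ≤ m → n ≤ o → m ∸ suc n + suc o ≡ m ∸ 1 + suc (o ∸ n)
m∸[1+n]+[1+o]≡m∸1+[1+o∸n] m {zero}  {o}     _   _         = refl
m∸[1+n]+[1+o]≡m∸1+[1+o∸n] m {suc n} {suc o} n<m (s≤s n≤o) =
  trans (m∸[1+n]+[1+o]≡m∸n+o m (suc o) n<m) (m∸[1+n]+[1+o]≡m∸1+[1+o∸n] m (ℕP.<⇒≤ n<m) n≤o)

module Recurrence {D : Poly → Set} (D-submodule : IsSubmodule D) (m : ℕ) (q : ℕ → Poly) (c lo : ℕ)
  (recurrence : ∀ s → lo ≤ s → s < c → D (lincomb (suc (suc m)) (signedBinom (suc m)) (λ l → q (s + l))))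
  where

  open IsSubmodule D-submodule

  private
    n : ℕ
    n = suc m

  target : ℕ → Poly
  target k = q (c ∸ 1 + suc k)

  tailCoeff : ℕ → ℕ → ℤ
  tailCoeff a k = sgn (suc (suc k)) ℤ.* β m a (suc k)

  tail : ℕ → Poly
  tail a = lincomb n (tailCoeff a) target

  private
    Reduces : ℕ → Set
    Reduces a = 1 ≤ a → a + lo ≤ c → D (q (c ∸ a) ⊖ tail a)

    reduction-step : ∀ a → (∀ {b} → b < a → Reduces b) → Reduces a
    reduction-step zero    _       ()
    reduction-step (suc a) reduces _ a+lo≤c =
      resp-≈ eliminate (⊕-closed (recurrence s lo≤s s<c) (lincomb-closed n (λ l → - signedBinom n (suc l)) E E∈D))
      where
      s : ℕ
      s = c ∸ suc a
      a<c : suc a ≤ c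
      a<c = ℕP.m+n≤o⇒m≤o (suc a) a+lo≤c
      lo≤s : lo ≤ s
      lo≤s = ℕP.m+n≤o⇒m≤o∸n lo (subst (_≤ c) (ℕP.+-comm (suc a) lo) a+lo≤c)
      s<c : s < c
      s<c = ℕP.∸-monoʳ-< (s≤s z≤n) a<c

      E : ℕ → Poly
      E l = q (s + suc l) ⊖ lincomb n (expansionCoeff m a l) target

      E∈D-below : ∀ {l} → l < a → D (E l)
      E∈D-below {l} l<a = resp-≈
        (λ i j → sym (cong₂ _-_
          (cong (λ x → q x i j) (trans (m∸[1+n]+[1+o]≡m∸n+o c l a<c)
                                       (m∸n+o≡m∸[n∸o] c (ℕP.<⇒≤ a<c) (ℕP.<⇒≤ l<a))))
          (∑<-cong′ n λ k → cong (ℤ._* target k i j) (expansionCoeff-< m k l<a))))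
        (reduces (s≤s (ℕP.m∸n≤m a l)) (ℕP.m<n⇒0<n∸m l<a)
           (ℕP.≤-trans (ℕP.+-monoˡ-≤ lo (ℕP.m∸n≤m a l)) (ℕP.≤-trans (ℕP.n≤1+n (a + lo)) a+lo≤c)))

      E∈D-above : ∀ {l} → l < n → l ≮ a → D (E l)
      E∈D-above {l} l<n l≮a = resp-≈ (λ i j → sym (begin
          q (s + suc l) i j - ∑< n (λ k → expansionCoeff m a l k ℤ.* target k i j)
            ≡⟨ cong₂ _-_ (cong (λ x → q x i j) (m∸[1+n]+[1+o]≡m∸1+[1+o∸n] c a<c (ℕP.≮⇒≥ l≮a)))
                         (∑<-single n (l ∸ a) (ℕP.≤-<-trans (ℕP.m∸n≤m l a) l<n) λ k _ k≢l∸a →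
                            trans (cong (ℤ._* target k i j) (trans (expansionCoeff-≮ m k l≮a) (δ-≢ k≢l∸a)))
                                  (ℤP.*-zeroˡ (target k i j))) ⟩
          target (l ∸ a) i j - expansionCoeff m a l (l ∸ a) ℤ.* target (l ∸ a) i j
            ≡⟨ cong (λ x → target (l ∸ a) i j - x ℤ.* target (l ∸ a) i j)
                    (trans (expansionCoeff-≮ m (l ∸ a) l≮a) (δ-refl (l ∸ a))) ⟩
          target (l ∸ a) i j - + 1 ℤ.* target (l ∸ a) i j
            ≡⟨ x-1x≡0 (target (l ∸ a) i j) ⟩
          + 0 ∎))
        0ᴾ-closed
        where
        x-1x≡0 : ∀ x → x - + 1 ℤ.* x ≡ + 0
        x-1x≡0 = ℤSolver.solve-∀

      E∈D : ∀ l → l < n → D (E l)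
      E∈D l l<n = case l <? a of λ where
        (yes l<a) → E∈D-below l<a
        (no l≮a)  → E∈D-above l<n l≮a

      eliminate : (lincomb (suc n) (signedBinom n) (λ l → q (s + l)) ⊕ lincomb n (λ l → - signedBinom n (suc l)) E)
                  ≈ (q (c ∸ suc a) ⊖ tail (suc a))
      eliminate i j = begin
        (lincomb (suc n) (signedBinom n) (λ l → q (s + l)) ⊕ lincomb n (λ l → - signedBinom n (suc l)) E) i j
          ≡⟨ ∑<-substitute n n (signedBinom n) (λ l → q (s + l) i j) (λ k → target k i j) (expansionCoeff m a) ⟩
        + 1 ℤ.* q (s + 0) i j ℤ.+ ∑< n (λ k → γ k ℤ.* target k i j)
          ≡⟨ cong₂ ℤ._+_ (trans (ℤP.*-identityˡ (q (s + 0) i j)) (cong (λ x → q x i j) (ℕP.+-identityʳ s)))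
                         (∑<-cong n λ k k<n → cong (ℤ._* target k i j) (∑<-signedBinom-expansionCoeff m a k k<n)) ⟩
        q s i j ℤ.+ ∑< n (λ k → - tailCoeff (suc a) k ℤ.* target k i j)
          ≡⟨ cong (λ x → q s i j ℤ.+ x)
                  (trans (∑<-cong′ n λ k → sym (ℤP.neg-distribˡ-* (tailCoeff (suc a) k) (target k i j))) (∑<-neg n _)) ⟩
        q s i j - tail (suc a) i j ∎
        where
        γ : ℕ → ℤ
        γ k = ∑< n (λ l → signedBinom n (suc l) ℤ.* expansionCoeff m a l k)

  reduce : ∀ a → 1 ≤ a → a + lo ≤ c → D (q (c ∸ a) ⊖ tail a)
  reduce = <-rec Reduces reduction-step

ε₁≤s⇒2m<b+s*p' : ∀ p' b m s → 2 ≤ b → m ≤ p' → ε₁ (suc p') b m ≤ s → suc (2 * m) ≤ b + s * p'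
ε₁≤s⇒2m<b+s*p' p' b m s 2≤b m≤p' ε₁≤s with suc (2 * m) ≤? b
... | yes 2m<b = ℕP.≤-trans 2m<b (ℕP.m≤m+n b (s * p'))
... | no _ with suc (2 * m) ≤? b + p'
...   | yes 2m<b+p' =
  ℕP.≤-trans 2m<b+p' (ℕP.+-monoʳ-≤ b (subst (_≤ s * p') (ℕP.*-identityˡ p') (ℕP.*-monoˡ-≤ p' ε₁≤s)))
...   | no _ =
  ℕP.≤-trans (ℕP.m≤n⇒m≤1+n (s≤s (ℕP.*-monoʳ-≤ 2 m≤p'))) (ℕP.+-mono-≤ 2≤b (ℕP.*-monoˡ-≤ p' ε₁≤s))

q-as-shifted-θTerm : ∀ p' b m s e₁ e₂ → suc (2 * m) + e₂ ≡ b + s * p' → ∀ l → l ≤ suc m →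
  q (suc p') (suc (b + (s + suc m) * p') + e₁) b m (s + l)
    ≈ mono (suc m + (suc m ∸ l) * p' + e₁) (suc m + l * p' + e₂)
q-as-shifted-θTerm p' b m s e₁ e₂ 2m+e₂≡b+sp' l l≤n i j = cong₂ (λ u v → mono u v i j) xExponent yExponent
  where
  n : ℕ
  n = suc m
  d : ℕ
  d = n ∸ l
  Y : ℕ
  Y = suc m + l * p' + e₂
  X : ℕ
  X = suc m + d * p' + e₁
  b+[s+k]p' : ∀ k → b + (s + k) * p' ≡ suc (2 * m) + e₂ + k * p'
  b+[s+k]p' k = trans (split b s k p') (cong (_+ k * p') (sym 2m+e₂≡b+sp'))
    where
    split : ∀ b s k p' → b + (s + k) * p' ≡ b + s * p' + k * p'
    split = ℕSolver.solve-∀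
  yExponent : (b + (s + l) * p') ∸ m ≡ Y
  yExponent = begin
    (b + (s + l) * p') ∸ m        ≡⟨ cong (_∸ m) (trans (b+[s+k]p' l) (regroup m e₂ (l * p'))) ⟩
    (m + Y) ∸ m                   ≡⟨ ℕP.m+n∸m≡n m Y ⟩
    Y                             ∎
    where
    regroup : ∀ m e x → suc (2 * m) + e + x ≡ m + (suc m + x + e)
    regroup = ℕSolver.solve-∀
  xExponent : suc (b + (s + n) * p') + e₁ ∸ ((b + (s + l) * p') ∸ m) ≡ X
  xExponent = begin
    suc (b + (s + n) * p') + e₁ ∸ ((b + (s + l) * p') ∸ m)
      ≡⟨ cong₂ _∸_ (cong (λ x → suc x + e₁) (b+[s+k]p' n)) yExponent ⟩
    suc (suc (2 * m) + e₂ + n * p') + e₁ ∸ Y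
      ≡⟨ cong (λ k → suc (suc (2 * m) + e₂ + k * p') + e₁ ∸ Y) (sym (ℕP.m+[n∸m]≡n l≤n)) ⟩
    suc (suc (2 * m) + e₂ + (l + d) * p') + e₁ ∸ Y
      ≡⟨ cong (_∸ Y) (regroup m e₂ e₁ l d p') ⟩
    Y + X ∸ Y
      ≡⟨ ℕP.m+n∸m≡n Y X ⟩
    X ∎
    where
    regroup : ∀ m e₂ e₁ l d p' → suc (suc (2 * m) + e₂ + (l + d) * p') + e₁
                                ≡ suc m + l * p' + e₂ + (suc m + d * p' + e₁)
    regroup = ℕSolver.solve-∀

q-recurrence : ∀ p' r b m s → suc (2 * m) ≤ b + s * p' → suc (b + (s + suc m) * p') ≤ r →
  Multiple (θ (suc p') ^ᴾ suc m) (lincomb (suc (suc m)) (signedBinom (suc m)) λ l → q (suc p') r b m (s + l))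
q-recurrence p' r b m s 2m<b+sp' r>b+[s+m+1]p'
  with ℕP.m≤n⇒∃[o]m+o≡n 2m<b+sp' | ℕP.m≤n⇒∃[o]m+o≡n r>b+[s+m+1]p'
... | e₂ , 2m+e₂≡b+sp' | e₁ , refl =
  IsSubmodule.resp-≈ (Multiple-isSubmodule (θ (suc p') ^ᴾ suc m))
    (λ i j → ∑<-cong (suc (suc m)) λ l l<n+1 →
      cong (signedBinom (suc m) l ℤ.*_)
           (sym (q-as-shifted-θTerm p' b m s e₁ e₂ 2m+e₂≡b+sp' l (ℕP.≤-pred l<n+1) i j)))
    (θ^⊗mono p' (suc m) e₁ e₂)

lemma4p1 : (p r b c m : ℕ) → Prime p → 5 ≤ p →
    2 ≤ b → b ≤ p → (+ (p ∸ 1)) ∣ (+ r - + b) →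
    suc (b + c * (p ∸ 1)) ≤ r →
    m + 1 + ε₁ p b m ≤ c → m ≤ p ∸ 1 →
    (a : ℕ) → 1 ≤ a → a + m + ε₁ p b m ≤ c →
    CongV p m (q p r b m (c ∸ m ∸ a))
      (polySum 1 (suc m) λ i →
        (sgn (suc i) Data.Integer.* β m a i) · q p r b m (c ∸ m ∸ 1 + i))
lemma4p1 zero r b c m _ () _ _ _ _ _ _ _ _ _
lemma4p1 (suc p') r b c m _ _ 2≤b _ _ r>b+cp' m+1+ε≤c m≤p' a 1≤a a+m+ε≤c =
  Multiple⇒DivByθPow (suc p') m
    (resp-≈ (λ i j → cong (λ x → q (suc p') r b m (c ∸ m ∸ a) i j - x) (sym (sumFromTo1≡∑< (suc m) _)))
            (reduce a 1≤a a+ε≤c∸m))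
  where
  open IsSubmodule (Multiple-isSubmodule (θ (suc p') ^ᴾ suc m))
  ε : ℕ
  ε = ε₁ (suc p') b m
  m≤c : m ≤ c
  m≤c = ℕP.m+n≤o⇒m≤o m (ℕP.m+n≤o⇒m≤o (m + 1) m+1+ε≤c)
  a+ε≤c∸m : a + ε ≤ c ∸ m
  a+ε≤c∸m = ℕP.m+n≤o⇒m≤o∸n (a + ε) (subst (_≤ c) (rearrange a m ε) a+m+ε≤c)
    where
    rearrange : ∀ a m e → a + m + e ≡ a + e + m
    rearrange = ℕSolver.solve-∀
  recurrence : ∀ s → ε ≤ s → s < c ∸ m →
    Multiple (θ (suc p') ^ᴾ suc m) (lincomb (suc (suc m)) (signedBinom (suc m)) λ l → q (suc p') r b m (s + l))
  recurrence s ε≤s s<c∸m = q-recurrence p' r b m s (ε₁≤s⇒2m<b+s*p' p' b m s 2≤b m≤p' ε≤s)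
    (ℕP.≤-trans (s≤s (ℕP.+-monoʳ-≤ b (ℕP.*-monoˡ-≤ p' s+m+1≤c))) r>b+cp')
    where
    s+m+1≤c : s + suc m ≤ c
    s+m+1≤c = subst (_≤ c) (sym (ℕP.+-suc s m)) (ℕP.m≤o∸n⇒m+n≤o (suc s) m≤c s<c∸m)
  open Recurrence (Multiple-isSubmodule (θ (suc p') ^ᴾ suc m)) m (q (suc p') r b m) (c ∸ m) ε recurrence
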